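{- In the intersection type system for $\lambda\mu$ defined below, the following rules are admissible. (Weakening) If $\Gamma\vdash T:\sigma\mid\Delta$, $\Gamma\subseteq\Gamma'$ and $\Delta\subseteq\Delta'$ (with $\Gamma'$ a basis and $\Delta'$ a context), then $\Gamma'\vdash T:\sigma\mid\Delta'$. (Thinning) If $\Gamma\vdash T:\sigma\mid\Delta$, $\Gamma'\supseteq\{x{:}\delta\in\Gamma\mid x\in\mathrm{fv}(T)\}$ and $\Delta'\supseteq\{\alpha{:}\kappa\in\Delta\mid\alpha\in\mathrm{fn}(T)\}$, then $\Gamma'\vdash T:\sigma\mid\Delta'$. In both rules, by convention no variable of $\Gamma'$ and no name of $\Delta'$ is bound in $T$.
   Context: Syntax. $\lambda\mu$-terms are $M::=x\mid\lambda x.M\mid MN\mid\mu\alpha.c$ and commands are $c::=[\alpha]M$; $T$ ranges over both. $\mathrm{fv}(T)$ and $\mathrm{fn}(T)$ are the free variables and free names. Types. Fix an $\omega$-algebraic lattice $R$ with compact elements $\mathcal K(R)$. Types are $\rho::=\psi_a\mid\omega\mid\rho\wedge\rho$ ($a\in\mathcal K(R)$), $\delta::=\rho\mid\kappa\to\rho\mid\omega\mid\delta\wedge\delta$, and $\kappa::=\delta\times\kappa\mid\omega\mid\kappa\wedge\kappa$; $\delta\times\kappa\to\rho$ means $(\delta\times\kappa)\to\rho$. The preorders $\le_R,\le_D,\le_C$ are the least preorders such that: - in each sort, $\wedge$ is meet and $\omega$ is top; - $\psi_\bot\sim\omega$ and $\psi_{a\sqcup b}\sim\psi_a\wedge\psi_b$;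 - $\rho_1\le_R\rho_2\Rightarrow\rho_1\le_D\rho_2$; - $\omega\le_D\omega\to\omega$, $\psi_a\le_D\omega\to\psi_a$, $\omega\to\psi_a\le_D\psi_a$, $\omega\le_C\omega\times\omega$; - $(\kappa\to\rho_1)\wedge(\kappa\to\rho_2)\le_D\kappa\to(\rho_1\wedge\rho_2)$; - $(\delta_1\times\kappa_1)\wedge(\delta_2\times\kappa_2)\le_C(\delta_1\wedge\delta_2)\times(\kappa_1\wedge\kappa_2)$; - $\to$ is contravariant in its left argument and covariant in its right argument; - $\times$ is covariant in both arguments. Bases and contexts. A basis $\Gamma$ is a finite map from term variables to $\delta$-types and a context $\Delta$ a finite map from names to $\kappa$-types. Set $\Gamma(x)=\omega$ if $x\notin\mathrm{dom}\,\Gamma$ and $\Delta(\alpha)=\omega$ if $\alpha\notin\mathrm{dom}\,\Delta$. $\Gamma\setminus x$ and $\Delta\setminus\alpha$ delete an entry; $\Gamma,x{:}\delta$ is legal only if $x\notin\mathrm{dom}\,\Gamma$ or $x{:}\delta\in\Gamma$. Rules (a term gets a $\delta$-type, a command a $\kappa$-type): - (Ax) $\Gamma,x{:}\delta\vdash x:\delta\mid\Delta$; - ($\lambda$) from $\Gamma\vdash M:\kappa\to\rho\mid\Delta$ infer $\Gamma\setminus x\vdash\lambda x.M:\Gamma(x)\times\kappa\to\rho\mid\Delta$; - (App) from $\Gamma\vdash M:\delta\times\kappa\to\rho\mid\Delta$ and $\Gamma\vdash N:\delta\mid\Delta$ infer $\Gamma\vdash MN:\kappa\to\rho\mid\Delta$;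 - (cmd) from $\Gamma\vdash M:\delta\mid\Delta$ infer $\Gamma\vdash[\alpha]M:\delta\times\Delta(\alpha)\mid\Delta$; - ($\mu$) from $\Gamma\vdash c:(\kappa'\to\rho)\times\kappa'\mid\Delta$ infer $\Gamma\vdash\mu\alpha.c:\Delta(\alpha)\to\rho\mid\Delta\setminus\alpha$; - ($\wedge$) from types $\sigma$ and $\tau$ for $T$ infer $\sigma\wedge\tau$; - ($\omega$) $\Gamma\vdash T:\omega\mid\Delta$; - ($\le$) from $\Gamma\vdash T:\sigma\mid\Delta$ and $\sigma\le\tau$ infer $\Gamma\vdash T:\tau\mid\Delta$. By convention, variables and names in $\Gamma,\Delta$ are never bound in $T$. -}

module Defs where

open import Level using (Level; Lift; suc; _⊔_) renaming (zero to lzero)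
open import Data.Nat as ℕ using (ℕ; _≤_; _≟_)
open import Data.Maybe using (Maybe; just; nothing; maybe)
open import Data.Product using (Σ; ∃; _×_; _,_; proj₁; proj₂)
open import Data.Sum using (_⊎_)
open import Data.Empty using (⊥)
open import Relation.Nullary using (¬_; yes; no)
open import Relation.Binary.PropositionalEquality using (_≡_; _≢_; refl)
open import Relation.Binary.Structures using (IsPartialOrder)

record CompleteLattice (c : Level) : Set (suc c) where
  field
    Carrier        : Set c
    _⊑_            : Carrier → Carrier → Set c
    isPartialOrder : IsPartialOrder _≡_ _⊑_
    ⋁              : (Carrier → Set c) → Carrier
    ⋁-upper        : ∀ (S : Carrier → Set c) x → S x → x ⊑ ⋁ S
    ⋁-least        : ∀ (S : Carrier → Set c) y → (∀ x → S x → x ⊑ y) → ⋁ S ⊑ y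

  ⊥L : Carrier
  ⊥L = ⋁ (λ _ → Lift c ⊥)

  _⊔L_ : Carrier → Carrier → Carrier
  a ⊔L b = ⋁ (λ x → (x ≡ a) ⊎ (x ≡ b))

  Directed : (Carrier → Set c) → Set c
  Directed S = (∃ λ x → S x)
             × (∀ x y → S x → S y → ∃ λ z → S z × x ⊑ z × y ⊑ z)

  IsCompact : Carrier → Set (suc c)
  IsCompact a = ∀ (S : Carrier → Set c) → Directed S → a ⊑ ⋁ S → ∃ λ s → S s × a ⊑ s

record OmegaAlgebraicLattice (c : Level) : Set (suc c) where
  field
    lattice   : CompleteLattice c
  open CompleteLattice lattice public
  field
    -- algebraic: every element x is the join (least upper bound) of the
    -- compact elements below it (stated as a lub property, to stay in Set c)
    algebraic : ∀ x y → (∀ a → IsCompact a → a ⊑ x → a ⊑ y) → x ⊑ y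
    enum      : ℕ → Carrier
    enum-compact : ∀ n → IsCompact (enum n)
    enum-onto : ∀ a → IsCompact a → ∃ λ n → enum n ≡ a

data Sort : Set where
  tm cm : Sort

data Syn : Sort → Set where
  var : ℕ → Syn tm
  lam : ℕ → Syn tm → Syn tm
  app : Syn tm → Syn tm → Syn tm
  mu  : ℕ → Syn cm → Syn tm
  cmd : ℕ → Syn tm → Syn cm

FV : ℕ → ∀ {s} → Syn s → Set
FV x (var y)   = x ≡ y
FV x (lam y M) = x ≢ y × FV x M
FV x (app M N) = FV x M ⊎ FV x N
FV x (mu α c)  = FV x c
FV x (cmd α M) = FV x M

FN : ℕ → ∀ {s} → Syn s → Set
FN α (var y)   = ⊥
FN α (lam y M) = FN α M
FN α (app M N) = FN α M ⊎ FN α N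
FN α (mu β c)  = α ≢ β × FN α c
FN α (cmd β M) = α ≡ β ⊎ FN α M

BV : ℕ → ∀ {s} → Syn s → Set
BV x (var y)   = ⊥
BV x (lam y M) = x ≡ y ⊎ BV x M
BV x (app M N) = BV x M ⊎ BV x N
BV x (mu α c)  = BV x c
BV x (cmd α M) = BV x M

BN : ℕ → ∀ {s} → Syn s → Set
BN α (var y)   = ⊥
BN α (lam y M) = BN α M
BN α (app M N) = BN α M ⊎ BN α N
BN α (mu β c)  = α ≡ β ⊎ BN α c
BN α (cmd β M) = BN α M

record FinMap {a} (A : Set a) : Set a where
  field
    get    : ℕ → Maybe A
    finite : ∃ λ n → ∀ x → n ≤ x → get x ≡ nothing
open FinMap public

module _ {a} {A : Set a} where

  _∈dom_ : ℕ → FinMap A → Set a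
  x ∈dom m = ∃ λ v → get m x ≡ just v

  _⊆_ : FinMap A → FinMap A → Set a
  m ⊆ m' = ∀ x v → get m x ≡ just v → get m' x ≡ just v

  _≐_ : FinMap A → FinMap A → Set a
  m ≐ m' = ∀ y → get m y ≡ get m' y

  _∖_ : FinMap A → ℕ → FinMap A
  get (m ∖ x) y with y ≟ x
  ... | yes _ = nothing
  ... | no  _ = get m y
  finite (m ∖ x) = proj₁ (finite m) , fin
    where
    fin : ∀ y → proj₁ (finite m) ≤ y → get (m ∖ x) y ≡ nothing
    fin y le with y ≟ x
    ... | yes _ = refl
    ... | no  _ = proj₂ (finite m) y le

module Typing {c : Level} (L : OmegaAlgebraicLattice c) where
  open OmegaAlgebraicLattice L

  infixr 6 _∧R_ _∧D_ _∧C_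
  infixr 5 _⇒_
  infixr 7 _⊗_

  data TyR : Set (suc c) where
    ψ    : (a : Carrier) → .(IsCompact a) → TyR
    ωR   : TyR
    _∧R_ : TyR → TyR → TyR

  mutual
    data TyD : Set (suc c) where
      ⌜_⌝  : TyR → TyD
      _⇒_  : TyC → TyR → TyD
      ωD   : TyD
      _∧D_ : TyD → TyD → TyD

    data TyC : Set (suc c) where
      _⊗_  : TyD → TyC → TyC
      ωC   : TyC
      _∧C_ : TyC → TyC → TyC

  data _≤R_ : TyR → TyR → Set (suc c) where
    reflR   : ∀ {ρ} → ρ ≤R ρ
    transR  : ∀ {ρ₁ ρ₂ ρ₃} → ρ₁ ≤R ρ₂ → ρ₂ ≤R ρ₃ → ρ₁ ≤R ρ₃
    ∧-lbˡR  : ∀ {ρ₁ ρ₂} → (ρ₁ ∧R ρ₂) ≤R ρ₁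
    ∧-lbʳR  : ∀ {ρ₁ ρ₂} → (ρ₁ ∧R ρ₂) ≤R ρ₂
    ∧-glbR  : ∀ {ρ ρ₁ ρ₂} → ρ ≤R ρ₁ → ρ ≤R ρ₂ → ρ ≤R (ρ₁ ∧R ρ₂)
    ω-topR  : ∀ {ρ} → ρ ≤R ωR
    ψ⊥≤ω    : ∀ .{p} → ψ ⊥L p ≤R ωR
    ω≤ψ⊥    : ∀ .{p} → ωR ≤R ψ ⊥L p
    ψ⊔≤∧    : ∀ {a b} .{pa pb pab} → ψ (a ⊔L b) pab ≤R (ψ a pa ∧R ψ b pb)
    ∧≤ψ⊔    : ∀ {a b} .{pa pb pab} → (ψ a pa ∧R ψ b pb) ≤R ψ (a ⊔L b) pab

  mutual
    data _≤D_ : TyD → TyD → Set (suc c) where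
      reflD   : ∀ {δ} → δ ≤D δ
      transD  : ∀ {δ₁ δ₂ δ₃} → δ₁ ≤D δ₂ → δ₂ ≤D δ₃ → δ₁ ≤D δ₃
      ∧-lbˡD  : ∀ {δ₁ δ₂} → (δ₁ ∧D δ₂) ≤D δ₁
      ∧-lbʳD  : ∀ {δ₁ δ₂} → (δ₁ ∧D δ₂) ≤D δ₂
      ∧-glbD  : ∀ {δ δ₁ δ₂} → δ ≤D δ₁ → δ ≤D δ₂ → δ ≤D (δ₁ ∧D δ₂)
      ω-topD  : ∀ {δ} → δ ≤D ωD
      embed   : ∀ {ρ₁ ρ₂} → ρ₁ ≤R ρ₂ → ⌜ ρ₁ ⌝ ≤D ⌜ ρ₂ ⌝
      ω≤ω⇒ω   : ωD ≤D (ωC ⇒ ωR)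
      ψ≤ω⇒ψ   : ∀ {a} .{p} → ⌜ ψ a p ⌝ ≤D (ωC ⇒ ψ a p)
      ω⇒ψ≤ψ   : ∀ {a} .{p} → (ωC ⇒ ψ a p) ≤D ⌜ ψ a p ⌝
      ⇒-∧     : ∀ {κ ρ₁ ρ₂} → ((κ ⇒ ρ₁) ∧D (κ ⇒ ρ₂)) ≤D (κ ⇒ (ρ₁ ∧R ρ₂))
      ⇒-mono  : ∀ {κ₁ κ₂ ρ₁ ρ₂} → κ₂ ≤C κ₁ → ρ₁ ≤R ρ₂ → (κ₁ ⇒ ρ₁) ≤D (κ₂ ⇒ ρ₂)

    data _≤C_ : TyC → TyC → Set (suc c) where
      reflC   : ∀ {κ} → κ ≤C κ
      transC  : ∀ {κ₁ κ₂ κ₃} → κ₁ ≤C κ₂ → κ₂ ≤C κ₃ → κ₁ ≤C κ₃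
      ∧-lbˡC  : ∀ {κ₁ κ₂} → (κ₁ ∧C κ₂) ≤C κ₁
      ∧-lbʳC  : ∀ {κ₁ κ₂} → (κ₁ ∧C κ₂) ≤C κ₂
      ∧-glbC  : ∀ {κ κ₁ κ₂} → κ ≤C κ₁ → κ ≤C κ₂ → κ ≤C (κ₁ ∧C κ₂)
      ω-topC  : ∀ {κ} → κ ≤C ωC
      ω≤ω⊗ω   : ωC ≤C (ωD ⊗ ωC)
      ⊗-∧     : ∀ {δ₁ δ₂ κ₁ κ₂} → ((δ₁ ⊗ κ₁) ∧C (δ₂ ⊗ κ₂)) ≤C ((δ₁ ∧D δ₂) ⊗ (κ₁ ∧C κ₂))
      ⊗-mono  : ∀ {δ₁ δ₂ κ₁ κ₂} → δ₁ ≤D δ₂ → κ₁ ≤C κ₂ → (δ₁ ⊗ κ₁) ≤C (δ₂ ⊗ κ₂)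

  Ty : Sort → Set (suc c)
  Ty tm = TyD
  Ty cm = TyC

  ω[_] : ∀ s → Ty s
  ω[ tm ] = ωD
  ω[ cm ] = ωC

  _∧S_ : ∀ {s} → Ty s → Ty s → Ty s
  _∧S_ {tm} = _∧D_
  _∧S_ {cm} = _∧C_

  _≤S_ : ∀ {s} → Ty s → Ty s → Set (suc c)
  _≤S_ {tm} = _≤D_
  _≤S_ {cm} = _≤C_

  Basis : Set (suc c)
  Basis = FinMap TyD

  Context : Set (suc c)
  Context = FinMap TyC

  _⟨_⟩ᵇ : Basis → ℕ → TyD
  Γ ⟨ x ⟩ᵇ = maybe (λ δ → δ) ωD (get Γ x)

  _⟨_⟩ᶜ : Context → ℕ → TyC
  Δ ⟨ α ⟩ᶜ = maybe (λ κ → κ) ωC (get Δ α)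

  infix 4 _⊢_∶_∣_

  data _⊢_∶_∣_ : Basis → ∀ {s} → Syn s → Ty s → Context → Set (suc c) where
    Ax   : ∀ {Γ Δ x δ} → get Γ x ≡ just δ → Γ ⊢ var x ∶ δ ∣ Δ
    Lam  : ∀ {Γ Γ₀ Δ x M κ ρ} → Γ ⊢ M ∶ κ ⇒ ρ ∣ Δ → Γ₀ ≐ (Γ ∖ x)
         → Γ₀ ⊢ lam x M ∶ (Γ ⟨ x ⟩ᵇ ⊗ κ) ⇒ ρ ∣ Δ
    App  : ∀ {Γ Δ M N δ κ ρ} → Γ ⊢ M ∶ (δ ⊗ κ) ⇒ ρ ∣ Δ → Γ ⊢ N ∶ δ ∣ Δ
         → Γ ⊢ app M N ∶ κ ⇒ ρ ∣ Δ
    Cmd  : ∀ {Γ Δ α M δ} → Γ ⊢ M ∶ δ ∣ Δ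
         → Γ ⊢ cmd α M ∶ δ ⊗ (Δ ⟨ α ⟩ᶜ) ∣ Δ
    Mu   : ∀ {Γ Δ Δ₀ α c κ' ρ} → Γ ⊢ c ∶ (κ' ⇒ ρ) ⊗ κ' ∣ Δ → Δ₀ ≐ (Δ ∖ α)
         → Γ ⊢ mu α c ∶ (Δ ⟨ α ⟩ᶜ) ⇒ ρ ∣ Δ₀
    Meet : ∀ {Γ Δ s} {T : Syn s} {σ τ} → Γ ⊢ T ∶ σ ∣ Δ → Γ ⊢ T ∶ τ ∣ Δ
         → Γ ⊢ T ∶ σ ∧S τ ∣ Δ
    Top  : ∀ {Γ Δ s} {T : Syn s} → Γ ⊢ T ∶ ω[ s ] ∣ Δ
    Sub  : ∀ {Γ Δ s} {T : Syn s} {σ τ} → Γ ⊢ T ∶ σ ∣ Δ → σ ≤S τ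
         → Γ ⊢ T ∶ τ ∣ Δ

module Submission where

open import Defs
open import Level using (Level)
open import Data.Product using (_×_; _,_; proj₁; proj₂)
open import Data.Sum using (_⊎_; inj₁; inj₂)
open import Data.Empty using (⊥-elim)
open import Data.Maybe using (Maybe; just; nothing; maybe)
open import Data.Nat using (ℕ; suc; _≟_; _⊔_; _≤_)
open import Data.Nat.Properties using (m≤m⊔n; m≤n⊔m; ≤-trans; <-irrefl)
open import Function using (id; _∘_)
open import Relation.Nullary using (¬_; yes; no)
open import Relation.Binary.PropositionalEquality
  using (_≡_; _≢_; refl; sym; trans; cong; subst)

-- Thinning is proved by induction on derivations, for the invariant that Γ' extends Γ
-- on the free variables of T and is extended by Γ on its bound variables (likewise
-- for names).  Under a binder x the premise basis Γ is matched by Γ' [ x ≔ Γ x ];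
-- the second half of the invariant is what guarantees that deleting x from it gives
-- back Γ'.

module _ {a} {A : Set a} where

  infixl 30 _[_≔_]
  infix 4 _⊆[_]_

  _[_≔_] : FinMap A → ℕ → Maybe A → FinMap A
  get (m [ x ≔ v ]) y with y ≟ x
  ... | yes _ = v
  ... | no  _ = get m y
  finite (m [ x ≔ v ]) = suc x ⊔ n , fin
    where
    n = proj₁ (finite m)
    fin : ∀ y → suc x ⊔ n ≤ y → get (m [ x ≔ v ]) y ≡ nothing
    fin y le with y ≟ x
    ... | yes refl = ⊥-elim (<-irrefl refl (≤-trans (m≤m⊔n (suc y) n) le))
    ... | no  _    = proj₂ (finite m) y (≤-trans (m≤n⊔m (suc x) n) le)

  get-≔-here : ∀ (m : FinMap A) x v → get (m [ x ≔ v ]) x ≡ v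
  get-≔-here m x v with x ≟ x
  ... | yes _  = refl
  ... | no x≢x = ⊥-elim (x≢x refl)

  get-≔-there : ∀ (m : FinMap A) {x y} v → y ≢ x → get (m [ x ≔ v ]) y ≡ get m y
  get-≔-there m {x} {y} v y≢x with y ≟ x
  ... | yes y≡x = ⊥-elim (y≢x y≡x)
  ... | no  _   = refl

  get-∖-here : ∀ (m : FinMap A) x → get (m ∖ x) x ≡ nothing
  get-∖-here m x with x ≟ x
  ... | yes _  = refl
  ... | no x≢x = ⊥-elim (x≢x refl)

  get-∖-there : ∀ (m : FinMap A) {x y} → y ≢ x → get (m ∖ x) y ≡ get m y
  get-∖-there m {x} {y} y≢x with y ≟ x
  ... | yes y≡x = ⊥-elim (y≢x y≡x)
  ... | no  _   = refl

  _⊆[_]_ : FinMap A → (ℕ → Set) → FinMap A → Set a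
  m ⊆[ P ] m' = ∀ x v → P x → get m x ≡ just v → get m' x ≡ just v

  module UnderBinder (m m₀ m' : FinMap A) (x : ℕ) (m₀≐m∖x : m₀ ≐ (m ∖ x)) where

    get-≐∖ : ∀ {y} → y ≢ x → get m₀ y ≡ get m y
    get-≐∖ y≢x = trans (m₀≐m∖x _) (get-∖-there m y≢x)

    free-under-binder : ∀ {P} → m₀ ⊆[ (λ y → y ≢ x × P y) ] m'
                      → m ⊆[ P ] m' [ x ≔ get m x ]
    free-under-binder m₀⊆m' y v Py my with y ≟ x
    ... | yes refl = my
    ... | no  y≢x  = m₀⊆m' y v (y≢x , Py) (trans (get-≐∖ y≢x) my)

    bound-under-binder : ∀ {B} → m' ⊆[ (λ y → y ≡ x ⊎ B y) ] m₀
                       → m' [ x ≔ get m x ] ⊆[ B ] m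
    bound-under-binder m'⊆m₀ y v By m''y with y ≟ x
    ... | yes refl = m''y
    ... | no  y≢x  = trans (sym (get-≐∖ y≢x)) (m'⊆m₀ y v (inj₂ By) m''y)

    ≐-under-binder : m' ⊆[ _≡ x ] m₀ → m' ≐ (m' [ x ≔ get m x ] ∖ x)
    ≐-under-binder m'⊆m₀ y with y ≟ x
    ... | no  y≢x  = sym (get-≔-there m' _ y≢x)
    ... | yes refl with get m' y in m'x
    ...   | nothing = refl
    ...   | just v with () ← trans (sym (m'⊆m₀ x v refl m'x))
                                   (trans (m₀≐m∖x x) (get-∖-here m x))

module _ {c : Level} (L : OmegaAlgebraicLattice c) where
  open Typing L

  ⟨⟩ᶜ-antitone : ∀ {Δ Δ' : Context} {α}
               → (∀ κ → get Δ α ≡ just κ → get Δ' α ≡ just κ) → (Δ' ⟨ α ⟩ᶜ) ≤C (Δ ⟨ α ⟩ᶜ)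
  ⟨⟩ᶜ-antitone {Δ} {α = α} Δα⇒Δ'α with get Δ α
  ... | nothing = ω-topC
  ... | just κ rewrite Δα⇒Δ'α κ refl = reflC

  thinning : ∀ {s} {T : Syn s} {σ : Ty s} {Γ Γ' : Basis} {Δ Δ' : Context}
           → Γ ⊢ T ∶ σ ∣ Δ
           → Γ ⊆[ (λ x → FV x T) ] Γ' → Δ ⊆[ (λ α → FN α T) ] Δ'
           → Γ' ⊆[ (λ x → BV x T) ] Γ → Δ' ⊆[ (λ α → BN α T) ] Δ
           → Γ' ⊢ T ∶ σ ∣ Δ'
  thinning {T = var x} (Ax Γx) fv fn bv bn = Ax (fv x _ refl Γx)
  thinning {T = lam x M} {Γ = Γ₀} {Γ'} {Δ' = Δ'}
           (Lam {Γ = Γ} {κ = κ} {ρ = ρ} ⊢M Γ₀≐Γ∖x) fv fn bv bn =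
    subst (λ δ → Γ' ⊢ lam x M ∶ (δ ⊗ κ) ⇒ ρ ∣ Δ')
          (cong (maybe id ωD) (get-≔-here Γ' x (get Γ x)))
          (Lam (thinning ⊢M (free-under-binder fv) fn (bound-under-binder bv) bn)
               (≐-under-binder (λ y δ → bv y δ ∘ inj₁)))
    where open UnderBinder Γ Γ₀ Γ' x Γ₀≐Γ∖x
  thinning (App ⊢M ⊢N) fv fn bv bn =
    App (thinning ⊢M (λ x δ → fv x δ ∘ inj₁) (λ α κ → fn α κ ∘ inj₁)
                     (λ x δ → bv x δ ∘ inj₁) (λ α κ → bn α κ ∘ inj₁))
        (thinning ⊢N (λ x δ → fv x δ ∘ inj₂) (λ α κ → fn α κ ∘ inj₂)
                     (λ x δ → bv x δ ∘ inj₂) (λ α κ → bn α κ ∘ inj₂))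
  thinning {T = cmd α M} {Δ = Δ} {Δ' = Δ'} (Cmd ⊢M) fv fn bv bn =
    Sub (Cmd (thinning ⊢M fv (λ β κ → fn β κ ∘ inj₂) bv bn))
        (⊗-mono reflD (⟨⟩ᶜ-antitone {Δ} {Δ'} (λ κ → fn α κ (inj₁ refl))))
  thinning {T = mu α C} {Γ' = Γ'} {Δ = Δ₀} {Δ'}
           (Mu {Δ = Δ} {ρ = ρ} ⊢C Δ₀≐Δ∖α) fv fn bv bn =
    subst (λ κ → Γ' ⊢ mu α C ∶ κ ⇒ ρ ∣ Δ')
          (cong (maybe id ωC) (get-≔-here Δ' α (get Δ α)))
          (Mu (thinning ⊢C fv (free-under-binder fn) bv (bound-under-binder bn))
              (≐-under-binder (λ β κ → bn β κ ∘ inj₁)))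
    where open UnderBinder Δ Δ₀ Δ' α Δ₀≐Δ∖α
  thinning (Meet ⊢σ ⊢τ) fv fn bv bn = Meet (thinning ⊢σ fv fn bv bn) (thinning ⊢τ fv fn bv bn)
  thinning Top fv fn bv bn = Top
  thinning (Sub ⊢σ σ≤τ) fv fn bv bn = Sub (thinning ⊢σ fv fn bv bn) σ≤τ

  thinning-fresh : ∀ {s} {T : Syn s} {σ : Ty s} {Γ Γ' : Basis} {Δ Δ' : Context}
                 → Γ ⊢ T ∶ σ ∣ Δ
                 → Γ ⊆[ (λ x → FV x T) ] Γ' → Δ ⊆[ (λ α → FN α T) ] Δ'
                 → (∀ x → x ∈dom Γ' → ¬ BV x T) → (∀ α → α ∈dom Δ' → ¬ BN α T)
                 → Γ' ⊢ T ∶ σ ∣ Δ'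
  thinning-fresh ⊢T fv fn fresh-x fresh-α =
    thinning ⊢T fv fn (λ x δ BVx Γ'x → ⊥-elim (fresh-x x (δ , Γ'x) BVx))
                      (λ α κ BNα Δ'α → ⊥-elim (fresh-α α (κ , Δ'α) BNα))

  weakening : ∀ {s} {T : Syn s} {σ : Ty s} {Γ Γ' : Basis} {Δ Δ' : Context}
            → Γ ⊢ T ∶ σ ∣ Δ → Γ ⊆ Γ' → Δ ⊆ Δ'
            → (∀ x → x ∈dom Γ' → ¬ BV x T) → (∀ α → α ∈dom Δ' → ¬ BN α T)
            → Γ' ⊢ T ∶ σ ∣ Δ'
  weakening ⊢T Γ⊆Γ' Δ⊆Δ' = thinning-fresh ⊢T (λ x δ _ → Γ⊆Γ' x δ) (λ α κ _ → Δ⊆Δ' α κ)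

lemma4p5 : ∀ {c : Level} (L : OmegaAlgebraicLattice c) → let open Typing L in
    (∀ {s} {T : Syn s} {σ : Ty s} {Γ Γ' : Basis} {Δ Δ' : Context}
       → Γ ⊢ T ∶ σ ∣ Δ → Γ ⊆ Γ' → Δ ⊆ Δ'
       → (∀ x → x ∈dom Γ' → ¬ BV x T) → (∀ α → α ∈dom Δ' → ¬ BN α T)
       → Γ' ⊢ T ∶ σ ∣ Δ')
    ×
    (∀ {s} {T : Syn s} {σ : Ty s} {Γ Γ' : Basis} {Δ Δ' : Context}
       → Γ ⊢ T ∶ σ ∣ Δ
       → (∀ x δ → FV x T → get Γ x ≡ just δ → get Γ' x ≡ just δ)
       → (∀ α κ → FN α T → get Δ α ≡ just κ → get Δ' α ≡ just κ)
       → (∀ x → x ∈dom Γ' → ¬ BV x T) → (∀ α → α ∈dom Δ' → ¬ BN α T)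
       → Γ' ⊢ T ∶ σ ∣ Δ')
lemma4p5 L = weakening L , thinning-fresh L
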